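{- Let $k,l$ be positive integers and $g=\lfloor k/l^2\rfloor$. Let $C^*=\{c^1,c^2,\dots,c^{k+gl}\}$ be a set of $k+gl$ distinct pages, and for $i=1,\dots,l+1$ define $$C^i=C^*\setminus\{c^{(i-1)gl+1},c^{(i-1)gl+2},\dots,c^{igl}\}.$$ Then for every set $Q$ of pages with $|Q|=l$, $$\prod_{i=1}^{l+1}\mathbb{1}_{\{Q\not\subseteq C^i\}}=\mathbb{1}_{\{Q\not\subseteq C^*\}},$$ i.e., $Q\subseteq C^*$ if and only if $Q\subseteq C^i$ for some $i\in\{1,\dots,l+1\}$.
   Context: Note $gl^2+gl\le k+gl$, so the sets $C^i$ are well defined, and each $C^i$ has exactly $k$ elements. -}

module Defs where

open import Data.Nat using (ℕ; zero; suc; _+_; _*_; _∸_; _≤_; _<_; NonZero)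
open import Data.Nat.DivMod using (_/_)
open import Data.Nat.Properties using (m*n≢0)
open import Data.Fin using (Fin; toℕ)
open import Data.Product using (Σ; _×_)
open import Relation.Binary.PropositionalEquality using (_≡_)
open import Relation.Nullary using (¬_)

gOf : (k l : ℕ) → .{{NonZero l}} → ℕ
gOf k l = _/_ k (l * l) {{m*n≢0 l l}}

-- The cache C* = { c¹, …, c^{k+gl} } is given by an injective map
-- c : Fin (k + g*l) → Page, where index j : Fin _ (0-based) is page c^{j+1}.
-- Membership in C*:
_∈C*[_] : ∀ {Page : Set} {N : ℕ} → Page → (Fin N → Page) → Set
q ∈C*[ c ] = Σ _ λ j → q ≡ c j

-- Membership in C^i = C* \ { c^{(i-1)gl+1}, …, c^{igl} }, i.e. the 0-based
-- index j must NOT satisfy (i-1)·gl ≤ j < i·gl.  Here m = g*l.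
InCi : ∀ {Page : Set} {N : ℕ} → (m i : ℕ) → (Fin N → Page) → Page → Set
InCi m i c q = Σ _ λ j → q ≡ c j × ¬ (((i ∸ 1) * m ≤ toℕ j) × (toℕ j < i * m))

module Submission where

open import Defs
open import Data.Nat using (ℕ; suc; _+_; _*_; _∸_; _≤_; _<_; NonZero; s≤s; z≤n; _≤?_; _<?_)
open import Data.Nat.Properties using (<-irrefl; ≤-reflexive; ≤-trans; *-monoˡ-≤; +-comm)
open import Data.Fin using (Fin; toℕ)
import Data.Fin as Fin
open import Data.Fin.Properties using (pigeonhole; ¬∀⟶∃¬; toℕ<n)
open import Data.List using (List; []; _∷_; length; lookup)
open import Data.List.Relation.Unary.All as All using (All; []; _∷_)
open import Data.List.Relation.Unary.All.Properties.Core using (¬Any⇒All¬)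
open import Data.List.Relation.Unary.Any as Any using (Any)
open import Data.List.Relation.Unary.Any.Properties using (lookup-index)
open import Data.List.Relation.Unary.Unique.Propositional using (Unique)
open import Data.Product using (Σ; ∃; _×_; _,_)
open import Data.Empty using (⊥)
open import Function using (_∘_)
open import Function.Definitions using (Injective)
open import Function.Bundles using (_⇔_; mk⇔)
open import Relation.Nullary using (¬_)
open import Relation.Nullary.Decidable using (_×-dec_)
open import Relation.Unary using (Pred; Decidable)
open import Relation.Binary.PropositionalEquality using (_≡_; refl; sym; cong; trans; subst)

-- The only counting fact used is |Q| = l < l + 1 = number of removed blocks: the
-- l + 1 blocks are pairwise disjoint, so by pigeonhole the indices of the pages
-- of Q miss one of them, and Q lies in the corresponding C^i.

module _ {a p} {A : Set a} {n : ℕ} (P : Fin n → Pred A p) (P? : ∀ i → Decidable (P i))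
         (disjoint : ∀ {i j x} → i Fin.< j → P i x → P j x → ⊥) where

  ¬all-classes-hit : (xs : List A) → length xs < n → ¬ (∀ i → Any (P i) xs)
  ¬all-classes-hit xs len<n hit with i , j , i<j , same ← pigeonhole len<n (Any.index ∘ hit)
    = disjoint i<j (lookup-index (hit i)) (subst (P j ∘ lookup xs) (sym same) (lookup-index (hit j)))

  missed-class : (xs : List A) → length xs < n → ∃ λ i → All (¬_ ∘ P i) xs
  missed-class xs len<n with i , ¬hit ← ¬∀⟶∃¬ n (λ i → Any (P i) xs) (λ i → Any.any? (P? i) xs)
                                                (¬all-classes-hit xs len<n)
    = i , ¬Any⇒All¬ xs ¬hit

InBlock : (m i j : ℕ) → Set
InBlock m i j = ((i ∸ 1) * m ≤ j) × (j < i * m)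

InBlock? : ∀ m i → Decidable (InBlock m i)
InBlock? m i j = ((i ∸ 1) * m ≤? j) ×-dec (j <? i * m)

blocks-disjoint : ∀ m {a b j} → a < b → InBlock m (suc a) j → InBlock m (suc b) j → ⊥
blocks-disjoint m a<b (_ , j<⟨a+1⟩m) (bm≤j , _) =
  <-irrefl refl (≤-trans j<⟨a+1⟩m (≤-trans (*-monoˡ-≤ m a<b) bm≤j))

module _ {a r} {A : Set a} {R : Pred A r} where

  length-toList : ∀ {xs} (rs : All R xs) → length (All.toList rs) ≡ length xs
  length-toList []       = refl
  length-toList (_ ∷ rs) = cong suc (length-toList rs)

  All-toList⁻ : ∀ {s} {S : Pred (∃ R) s} {xs} (rs : All R xs) →
                All S (All.toList rs) → All (λ x → Σ (R x) (λ r → S (x , r))) xs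
  All-toList⁻ []       []       = []
  All-toList⁻ (r ∷ rs) (s ∷ ss) = (r , s) ∷ All-toList⁻ rs ss

lemma5p3 : (k l : ℕ) → .{{_ : NonZero k}} → .{{_ : NonZero l}} →
    (Page : Set) → (c : Fin (k + gOf k l * l) → Page) → Injective _≡_ _≡_ c →
    (Q : List Page) → Unique Q → length Q ≡ l →
    (All (λ q → q ∈C*[ c ]) Q ⇔
      Σ ℕ λ i → (1 ≤ i × i ≤ l + 1) × All (InCi (gOf k l * l) i c) Q)
lemma5p3 k l Page c _ Q _ |Q|≡l = mk⇔ to from
  where
  m = gOf k l * l

  Block : Fin (suc l) → Pred (∃ λ q → q ∈C*[ c ]) _
  Block a (_ , j , _) = InBlock m (suc (toℕ a)) (toℕ j)

  Block? : ∀ a → Decidable (Block a)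
  Block? a (_ , j , _) = InBlock? m (suc (toℕ a)) (toℕ j)

  fewer-pages-than-blocks : (Q⊆C* : All (_∈C*[ c ]) Q) → length (All.toList Q⊆C*) < suc l
  fewer-pages-than-blocks Q⊆C* = s≤s (≤-reflexive (trans (length-toList Q⊆C*) |Q|≡l))

  to : All (_∈C*[ c ]) Q → Σ ℕ λ i → (1 ≤ i × i ≤ l + 1) × All (InCi m i c) Q
  to Q⊆C* with a , ∉block-a ← missed-class Block Block? (blocks-disjoint m)
                                             (All.toList Q⊆C*) (fewer-pages-than-blocks Q⊆C*)
    = suc (toℕ a) , (s≤s z≤n , subst (suc (toℕ a) ≤_) (+-comm 1 l) (toℕ<n a))
    , All.map (λ ((j , q≡cj) , ∉block) → j , q≡cj , ∉block) (All-toList⁻ Q⊆C* ∉block-a)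

  from : (Σ ℕ λ i → (1 ≤ i × i ≤ l + 1) × All (InCi m i c) Q) → All (_∈C*[ c ]) Q
  from (_ , _ , Q⊆Ci) = All.map (λ (j , q≡cj , _) → j , q≡cj) Q⊆Ci
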